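{- Let $B=\{a_1<\dots<a_r\}$ be a totally ordered alphabet and $n\ge1$. The $K$-linear map $f:W_n^r\to P_n^r$ with $f(w)=\{w\}$ for each word $w$ is an isomorphism of left $K\mathfrak S_n$-modules, where $\mathfrak S_n$ acts on $W_n^r$ on the left by $\sigma\circ P=P\cdot\sigma^{ -1}$; i.e. $f(P\cdot\sigma^{ -1})=\sigma\cdot f(P)$ for all $\sigma\in\mathfrak S_n$ and $P\in W_n^r$. Its restriction to $W_n^\lambda$ is an isomorphism onto $T_n^\lambda$ for every partition $\lambda$ of $n$ with $r$ parts. Moreover, for every word $w$ of length $n$ with $alph(w)=B$, \[ f(w\cdot l_n^*)=l_n\cdot\{w\}. \]
   Context: $K$ is a commutative ring with unity, $[n]=\{1,\dots,n\}$, $\mathfrak S_n$ the symmetric group with product $\sigma\tau=\sigma\circ\tau$. $\mathfrak S_n$ acts on the right on words of length $n$ by place permutation $(y_1\cdots y_n)\cdot\sigma=y_{\sigma(1)}\cdots y_{\sigma(n)}$, extended linearly to $K\mathfrak S_n$ and to polynomials. $W_n^r$ is the $K$-span of the words $w$ of length $n$ with $alph(w)=B$ (set of occurring letters equal to $B$); for $\lambda=(\lambda_1,\dots,\lambda_r)$, $W_n^\lambda$ is the $K$-span of words with exactly $\lambda_k$ occurrences of $a_k$ for each $k$. $P_n^r$ is the free $K$-module on ordered set partitions $(I_1,\dots,I_r)$ of $[n]$ into $r$ nonempty blocks, and $T_n^\lambda$ the submodule spanned by those with $|I_k|=\lambda_k$ ($\lambda$-tabloids); $\mathfrak S_n$ acts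 on the left by $\sigma\cdot(I_1,\dots,I_r)=(\sigma(I_1),\dots,\sigma(I_r))$, extended linearly. For $w=y_1\cdots y_n$ with $alph(w)=B$, $\{w\}=(I_1(w),\dots,I_r(w))$ with $I_k(w)=\{i: y_i=a_k\}$. The left normed Lie bracketing is $l(a)=a$, $l(ua)=l(u)a-a\,l(u)$, and $l^*$ its adjoint with respect to the scalar product making words orthonormal, i.e. $(l^*(u),v)=(l(v),u)$ for all words. For distinct letters $x_1,\dots,x_n$, $l_n,l_n^*\in K\mathfrak S_n$ are defined by $(x_1\cdots x_n)\cdot l_n=l(x_1\cdots x_n)$ and $(x_1\cdots x_n)\cdot l_n^*=l^*(x_1\cdots x_n)$. -}

module Defs where

open import Level using (Level)
open import Algebra.Bundles using (CommutativeRing)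
open import Data.Nat as ℕ using (ℕ; zero; suc; _≤_)
open import Data.Fin as Fin using (Fin)
open import Data.Fin.Subset as Sub using (Subset; Nonempty; ∣_∣)
open import Data.Fin.Permutation using (Permutation; _⟨$⟩ʳ_; _⟨$⟩ˡ_)
open import Data.Vec as Vec using (Vec; []; _∷_; lookup; tabulate; reverse; _∷ʳ_; count)
open import Data.Vec.Properties using (≡-dec)
open import Data.Vec.Membership.Propositional as VM using ()
open import Data.List as List using (List; []; _∷_; _++_; concatMap)
open import Data.Bool using (Bool; if_then_else_)
open import Data.Bool.Properties using () renaming (_≟_ to _≟ᵇ_)
open import Data.Product using (_×_; _,_; ∃; ∃-syntax)
open import Relation.Binary.PropositionalEquality using (_≡_)
open import Relation.Binary.Definitions using (DecidableEquality)
open import Relation.Nullary using (¬_; does)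
open import Relation.Nullary.Decidable using (⌊_⌋)

-- words of length n over the ordered alphabet B = {a_1 < ... < a_r} ≅ Fin r
Word : ℕ → ℕ → Set
Word n r = Vec (Fin r) n

_≟ʷ_ : ∀ {n r} → DecidableEquality (Word n r)
_≟ʷ_ = ≡-dec Fin._≟_

AlphIsB : ∀ {n r} → Word n r → Set
AlphIsB {n} {r} w = ∀ (k : Fin r) → k VM.∈ w

occ : ∀ {n r} → Fin r → Word n r → ℕ
occ k w = count (Fin._≟ k) w

HasContent : ∀ {n r} → Vec ℕ r → Word n r → Set
HasContent {n} {r} λ' w = ∀ (k : Fin r) → occ k w ≡ lookup λ' k

-- raw r-tuples of subsets of [n] (the basis of P_n^r is a subset of these)
RawPart : ℕ → ℕ → Set
RawPart n r = Vec (Subset n) r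

_≟ᵖ_ : ∀ {n r} → DecidableEquality (RawPart n r)
_≟ᵖ_ = ≡-dec (≡-dec _≟ᵇ_)

IsOSP : ∀ {n r} → RawPart n r → Set
IsOSP {n} {r} I =
  (∀ (k : Fin r) → Nonempty (lookup I k)) ×
  (∀ (i : Fin n) → ∃[ k ] (i Sub.∈ lookup I k × (∀ (k' : Fin r) → i Sub.∈ lookup I k' → k' ≡ k)))

IsTabloid : ∀ {n r} → Vec ℕ r → RawPart n r → Set
IsTabloid {n} {r} λ' I = IsOSP I × (∀ (k : Fin r) → ∣ lookup I k ∣ ≡ lookup λ' k)

IsPartitionWithParts : (n r : ℕ) → Vec ℕ r → Set
IsPartitionWithParts n r λ' =
  Vec.sum λ' ≡ n ×
  (∀ (k : Fin r) → 1 ≤ lookup λ' k) ×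
  (∀ (i j : Fin r) → i Fin.≤ j → lookup λ' j ≤ lookup λ' i)

blocks : ∀ {n r} → Word n r → RawPart n r
blocks w = tabulate (λ k → tabulate (λ i → ⌊ lookup w i Fin.≟ k ⌋))

_·ᵖ_ : ∀ {A : Set} {n} → Vec A n → Permutation n n → Vec A n
w ·ᵖ σ = tabulate (λ i → lookup w (σ ⟨$⟩ʳ i))

_·ᵖ⁻¹_ : ∀ {A : Set} {n} → Vec A n → Permutation n n → Vec A n
w ·ᵖ⁻¹ σ = tabulate (λ i → lookup w (σ ⟨$⟩ˡ i))

-- image σ(S) of a subset: j ∈ σ(S) iff σ⁻¹(j) ∈ S
imageSub : ∀ {n} → Permutation n n → Subset n → Subset n
imageSub σ S = tabulate (λ j → lookup S (σ ⟨$⟩ˡ j))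

_·ᵗ_ : ∀ {n r} → Permutation n n → RawPart n r → RawPart n r
σ ·ᵗ I = Vec.map (imageSub σ) I

-- the word x_1 x_2 ... x_n in n distinct letters (letters = Fin n)
idWord : ∀ n → Vec (Fin n) n
idWord n = tabulate (λ i → i)

module _ {c ℓ : Level} (K : CommutativeRing c ℓ) where
  open CommutativeRing K

  LC : Set → Set c
  LC B = List (Carrier × B)

  coeff : ∀ {B : Set} → DecidableEquality B → LC B → B → Carrier
  coeff _≟_ [] b = 0#
  coeff _≟_ ((x , u) ∷ P) b = (if does (u ≟ b) then x else 0#) + coeff _≟_ P b

  LCEq : ∀ {B : Set} → DecidableEquality B → LC B → LC B → Set ℓ
  LCEq _≟_ P Q = ∀ b → coeff _≟_ P b ≈ coeff _≟_ Q b

  InSpan : ∀ {B : Set} → DecidableEquality B → (B → Set) → LC B → Set ℓ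
  InSpan {B} _≟_ Basis P = ∀ (b : B) → ¬ Basis b → coeff _≟_ P b ≈ 0#

  linExt : ∀ {B B' : Set} → (B → B') → LC B → LC B'
  linExt g P = List.map (λ { (x , u) → (x , g u) }) P

  basis : ∀ {B : Set} → B → LC B
  basis u = (1# , u) ∷ []

  GroupAlg : ℕ → Set c
  GroupAlg n = LC (Permutation n n)

  actR : ∀ {A : Set} {n} → LC (Vec A n) → GroupAlg n → LC (Vec A n)
  actR P L = concatMap (λ { (x , w) → List.map (λ { (y , σ) → (x * y , w ·ᵖ σ) }) L }) P

  actL : ∀ {n r} → GroupAlg n → LC (RawPart n r) → LC (RawPart n r)
  actL L T = concatMap (λ { (y , σ) → List.map (λ { (x , I) → (y * x , σ ·ᵗ I) }) T }) L

  actInvW : ∀ {n r} → Permutation n n → LC (Word n r) → LC (Word n r)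
  actInvW σ P = linExt (λ w → w ·ᵖ⁻¹ σ) P

  f : ∀ {n r} → LC (Word n r) → LC (RawPart n r)
  f P = linExt blocks P

  -- left normed bracketing, computed on the reversed word:
  -- lRev (reverse (u a)) = l(u a) = l(u) a - a l(u),  l(a) = a
  lRev : ∀ {A : Set} {m} → Vec A (suc m) → LC (Vec A (suc m))
  lRev (a ∷ []) = basis (a ∷ [])
  lRev (a ∷ b ∷ u) =
    List.map (λ { (x , v) → (x , v ∷ʳ a) }) (lRev (b ∷ u)) ++
    List.map (λ { (x , v) → (- x , a ∷ v) }) (lRev (b ∷ u))

  lBr : ∀ {A : Set} {m} → Vec A (suc m) → LC (Vec A (suc m))
  lBr w = lRev (reverse w)

-- The map w ↦ {w} is a bijection from the words with alphabet B onto the ordered set partitions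
-- into r blocks (its inverse assigns to each position the index of the block containing it), and
-- it turns the number of occurrences of a_k into |I_k|; a bijection of bases extends to an
-- isomorphism of free modules.  Equivariance is the identity {w·σ⁻¹} = σ·{w}.  For the last claim
-- write l(x₁⋯xₙ) = Σ ±(x₁⋯xₙ)·π over permutations π (every term of the bracketing rearranges its
-- letters).  Since l commutes with renaming letters, l(v) = Σ ±v·π for every word v, so the
-- defining property of l_n^* gives (x₁⋯xₙ)·l_n^* = Σ ±(x₁⋯xₙ)·π⁻¹ and therefore
-- f(w·l_n^*) = Σ ±{w·π⁻¹} = Σ ±π·{w} = l_n·{w}.
module Submission where

open import Level using (0ℓ)
open import Algebra.Bundles using (CommutativeRing)
open import Data.Bool using (Bool; true; false; if_then_else_)
open import Data.Empty using (⊥-elim)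
open import Data.Fin using (Fin; zero; suc; _≟_)
open import Data.Fin.Properties using (any?; all?)
open import Data.Fin.Permutation as Perm
  using (Permutation; _⟨$⟩ʳ_; _⟨$⟩ˡ_; _∘ₚ_; lift₀; transpose; inverseˡ; inverseʳ)
open import Data.Fin.Subset using (_∈_; ∣_∣)
open import Data.Fin.Subset.Properties using (_∈?_; ⊆-antisym)
open import Data.List as List using (List; _∷_; []; _++_; deduplicate)
open import Data.List.Membership.Propositional using () renaming (_∈_ to _∈ₗ_)
open import Data.List.Membership.Propositional.Properties using (∈-deduplicate⁺; ∈-++⁺ˡ; ∈-++⁺ʳ)
open import Data.List.Properties using (map-∘; map-cong; map-++)
open import Data.List.Relation.Binary.Subset.Propositional using (_⊆_)
open import Data.List.Relation.Unary.All as All using (All; _∷_; [])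
open import Data.List.Relation.Unary.All.Properties using (++⁺; map⁺)
open import Data.List.Relation.Unary.AllPairs using (_∷_)
import Data.List.Relation.Unary.Any as ListAny
open import Data.List.Relation.Unary.Unique.Propositional using (Unique)
import Data.List.Relation.Unary.Unique.DecPropositional.Properties as Unique
open import Data.Nat using (ℕ; suc; _≤_)
open import Data.Product using (_×_; _,_; proj₁; proj₂; ∃-syntax)
open import Data.Vec as Vec using (Vec; []; _∷_; lookup; tabulate; reverse; _∷ʳ_)
open import Data.Vec.Membership.Propositional.Properties using (∈-lookup)
import Data.Vec.Membership.Propositional as VecMembership
open import Data.Vec.Properties
  using (lookup∘tabulate; tabulate∘lookup; tabulate-cong; tabulate-∘; lookup-map; []=⇒lookup; lookup⇒[]=;
         map-∷ʳ; map-reverse; reverse-∷)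
open import Data.Vec.Relation.Unary.Any using (here; there; index)
open import Data.Vec.Relation.Unary.Any.Properties using (lookup-index)
open import Function using (_∘_)
open import Function.Bundles using (_⇔_; mk⇔; Equivalence)
open import Function.Definitions using (Injective)
import Function.Properties.Equivalence as ⇔
open import Relation.Binary.Bundles using (Setoid)
open import Relation.Binary.Definitions using (DecidableEquality)
open import Relation.Binary.PropositionalEquality
import Relation.Binary.Reasoning.Setoid as SetoidReasoning
open import Relation.Nullary using (Dec; yes; no; does)
open import Relation.Nullary.Decidable using (⌊_⌋; _×-dec_; does-⇔)

open import Defs

private
  variable
    A : Set
    n r : ℕ

map-commute : ∀ {b c d e} {B : Set b} {C : Set c} {D : Set d} {E : Set e}
                {f : B → C} {g : E → B} {f′ : D → C} {g′ : E → D} → (∀ x → f (g x) ≡ f′ (g′ x)) →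
                (xs : List E) → List.map f (List.map g xs) ≡ List.map f′ (List.map g′ xs)
map-commute commutes xs = trans (sym (map-∘ xs)) (trans (map-cong commutes xs) (map-∘ xs))

Vec-ext : {u v : Vec A n} → (∀ i → lookup u i ≡ lookup v i) → u ≡ v
Vec-ext {u = u} {v} eq = trans (sym (tabulate∘lookup u)) (trans (tabulate-cong eq) (tabulate∘lookup v))

isYes⇔ : ∀ {P : Set} (P? : Dec P) → ⌊ P? ⌋ ≡ true ⇔ P
isYes⇔ (yes p) = mk⇔ (λ _ → p) (λ _ → refl)
isYes⇔ (no ¬p) = mk⇔ (λ ()) (λ p → ⊥-elim (¬p p))

∈-tabulate : ∀ {P : Fin n → Set} (P? : ∀ i → Dec (P i)) {i} → i ∈ tabulate (λ j → ⌊ P? j ⌋) ⇔ P i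
∈-tabulate P? {i} = mk⇔
  (λ i∈ → Equivalence.to (isYes⇔ (P? i)) (trans (sym (lookup∘tabulate _ i)) ([]=⇒lookup i∈)))
  (λ p → lookup⇒[]= i _ (trans (lookup∘tabulate _ i) (Equivalence.from (isYes⇔ (P? i)) p)))

-- Ordered set partitions of words

RawPart-ext : {I J : RawPart n r} → (∀ k i → i ∈ lookup I k ⇔ i ∈ lookup J k) → I ≡ J
RawPart-ext eq = Vec-ext λ k → ⊆-antisym (Equivalence.to (eq k _)) (Equivalence.from (eq k _))

∈-blocks : ∀ (u : Word n r) {k i} → i ∈ lookup (blocks u) k ⇔ lookup u i ≡ k
∈-blocks u {k} {i} =
  subst (λ S → i ∈ S ⇔ lookup u i ≡ k) (sym (lookup∘tabulate _ k)) (∈-tabulate (λ j → lookup u j ≟ k))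

blocks-injective : Injective _≡_ _≡_ (blocks {n} {r})
blocks-injective {x = u} {y = v} eq = Vec-ext λ i → Equivalence.to (∈-blocks u)
  (subst (λ I → i ∈ lookup I (lookup v i)) (sym eq) (Equivalence.from (∈-blocks v) refl))

AlphIsB⇒IsOSP : (u : Word n r) → AlphIsB u → IsOSP (blocks u)
AlphIsB⇒IsOSP u alph =
  (λ k → index (alph k) , Equivalence.from (∈-blocks u) (sym (lookup-index (alph k)))) ,
  (λ i → lookup u i , Equivalence.from (∈-blocks u) refl , λ k i∈ → sym (Equivalence.to (∈-blocks u) i∈))

IsOSP⇒AlphIsB : (u : Word n r) → IsOSP (blocks u) → AlphIsB u
IsOSP⇒AlphIsB u (nonempty , _) k =
  let i , i∈ = nonempty k in subst (VecMembership._∈ u) (Equivalence.to (∈-blocks u) i∈) (∈-lookup i u)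

IsOSP⇒blocks : (I : RawPart n r) → IsOSP I → ∃[ u ] blocks u ≡ I
IsOSP⇒blocks I (_ , partition) = u , RawPart-ext λ k i → ⇔.trans (∈-blocks u) (mk⇔
    (λ uᵢ≡k → subst (λ k → i ∈ lookup I k) (trans (sym (lookup∘tabulate _ i)) uᵢ≡k) (block∋ i))
    (λ i∈ → trans (lookup∘tabulate _ i) (sym (only-block i k i∈))))
  where
  u : Word _ _
  u = tabulate (proj₁ ∘ partition)
  block∋ : ∀ i → i ∈ lookup I (proj₁ (partition i))
  block∋ i = proj₁ (proj₂ (partition i))
  only-block : ∀ i k → i ∈ lookup I k → k ≡ proj₁ (partition i)
  only-block i = proj₂ (proj₂ (partition i))

-- Any preimage must be the word that records, at each position, the block containing it.
blocks⁻¹? : (I : RawPart n r) → Dec (∃[ u ] blocks u ≡ I)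
blocks⁻¹? I with all? (λ i → any? (λ k → i ∈? lookup I k))
... | no uncovered = no λ (u , blocks≡I) → uncovered λ i →
  lookup u i , subst (λ J → i ∈ lookup J (lookup u i)) blocks≡I (Equivalence.from (∈-blocks u) refl)
... | yes cover with blocks (tabulate (proj₁ ∘ cover)) ≟ᵖ I
...   | yes blocks≡I = yes (tabulate (proj₁ ∘ cover) , blocks≡I)
...   | no blocks≢I = no λ (u , blocks≡I) → blocks≢I (trans (cong blocks (read-off u blocks≡I)) blocks≡I)
  where
  read-off : ∀ u → blocks u ≡ I → tabulate (proj₁ ∘ cover) ≡ u
  read-off u blocks≡I = Vec-ext λ i → trans (lookup∘tabulate _ i)
    (sym (Equivalence.to (∈-blocks u) (subst (λ J → i ∈ lookup J _) (sym blocks≡I) (proj₂ (cover i)))))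

∣blocks∣≡occ : (u : Word n r) (k : Fin r) → ∣ lookup (blocks u) k ∣ ≡ occ k u
∣blocks∣≡occ {r = r} u k = trans (cong ∣_∣ (lookup∘tabulate _ k)) (∣indicator∣ u)
  where
  ∣indicator∣ : ∀ {n} (u : Word n r) → ∣ tabulate (λ i → ⌊ lookup u i ≟ k ⌋) ∣ ≡ occ k u
  ∣indicator∣ [] = refl
  ∣indicator∣ (x ∷ u) with x ≟ k
  ... | yes _ = cong suc (∣indicator∣ u)
  ... | no _ = ∣indicator∣ u

occ-positive⇒∈ : (k : Fin r) (w : Word n r) → 1 ≤ occ k w → k VecMembership.∈ w
occ-positive⇒∈ k (x ∷ w) 1≤occ with x ≟ k
... | yes x≡k = here (sym x≡k)
... | no _ = there (occ-positive⇒∈ k w 1≤occ)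

HasContent⇒IsTabloid : (λ' : Vec ℕ r) → (∀ k → 1 ≤ lookup λ' k) →
                       (u : Word n r) → HasContent λ' u → IsTabloid λ' (blocks u)
HasContent⇒IsTabloid λ' positive u content =
  AlphIsB⇒IsOSP u (λ k → occ-positive⇒∈ k u (subst (1 ≤_) (sym (content k)) (positive k))) ,
  λ k → trans (∣blocks∣≡occ u k) (content k)

IsTabloid⇒HasContent : (λ' : Vec ℕ r) (u : Word n r) → IsTabloid λ' (blocks u) → HasContent λ' u
IsTabloid⇒HasContent λ' u (_ , sizes) k = trans (sym (∣blocks∣≡occ u k)) (sizes k)

∈-·ᵗ : ∀ (σ : Permutation n n) (I : RawPart n r) {k j} →
       j ∈ lookup (σ ·ᵗ I) k ⇔ σ ⟨$⟩ˡ j ∈ lookup I k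
∈-·ᵗ σ I {k} {j} = subst (λ S → j ∈ S ⇔ σ ⟨$⟩ˡ j ∈ lookup I k) (sym (lookup-map k (imageSub σ) I)) (mk⇔
  (λ j∈ → lookup⇒[]= _ _ (trans (sym (lookup∘tabulate _ j)) ([]=⇒lookup j∈)))
  (λ σ⁻¹j∈ → lookup⇒[]= j _ (trans (lookup∘tabulate _ j) ([]=⇒lookup σ⁻¹j∈))))

blocks-·ᵖ⁻¹ : (σ : Permutation n n) (w : Word n r) → blocks (w ·ᵖ⁻¹ σ) ≡ σ ·ᵗ blocks w
blocks-·ᵖ⁻¹ σ w = RawPart-ext λ k j → begin
  j ∈ lookup (blocks (w ·ᵖ⁻¹ σ)) k  ≈⟨ ∈-blocks (w ·ᵖ⁻¹ σ) ⟩
  lookup (w ·ᵖ⁻¹ σ) j ≡ k          ≈⟨ mk⇔ (trans (sym lookup-w·σ⁻¹)) (trans lookup-w·σ⁻¹) ⟩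
  lookup w (σ ⟨$⟩ˡ j) ≡ k          ≈⟨ ∈-blocks w ⟨
  σ ⟨$⟩ˡ j ∈ lookup (blocks w) k   ≈⟨ ∈-·ᵗ σ (blocks w) ⟨
  j ∈ lookup (σ ·ᵗ blocks w) k     ∎
  where
  open SetoidReasoning (⇔.⇔-setoid 0ℓ)
  lookup-w·σ⁻¹ : ∀ {j} → lookup (w ·ᵖ⁻¹ σ) j ≡ lookup w (σ ⟨$⟩ˡ j)
  lookup-w·σ⁻¹ {j} = lookup∘tabulate _ j

-- Place permutations

lookup-idWord-·ᵖ : (σ : Permutation n n) (i : Fin n) → lookup (idWord n ·ᵖ σ) i ≡ σ ⟨$⟩ʳ i
lookup-idWord-·ᵖ σ i = trans (lookup∘tabulate _ i) (lookup∘tabulate _ (σ ⟨$⟩ʳ i))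

map-lookup-idWord : (v : Vec A n) → Vec.map (lookup v) (idWord n) ≡ v
map-lookup-idWord v = trans (sym (tabulate-∘ (lookup v) (λ i → i))) (tabulate∘lookup v)

map-lookup-·ᵖ : (w : Vec A n) (σ : Permutation n n) → Vec.map (lookup w) (idWord n ·ᵖ σ) ≡ w ·ᵖ σ
map-lookup-·ᵖ w σ =
  trans (sym (tabulate-∘ _ _)) (tabulate-cong λ i → cong (lookup w) (lookup∘tabulate _ (σ ⟨$⟩ʳ i)))

-- Place permutation by σ⁻¹ is, definitionally, place permutation by flip σ.
map-lookup-·ᵖ⁻¹ : (w : Vec A n) (σ : Permutation n n) →
                  Vec.map (lookup w) (idWord n ·ᵖ⁻¹ σ) ≡ w ·ᵖ⁻¹ σ
map-lookup-·ᵖ⁻¹ w σ = map-lookup-·ᵖ w (Perm.flip σ)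

·ᵖ-inverse : (u v : Vec A n) (π : Permutation n n) → u ·ᵖ π ≡ v ⇔ u ≡ v ·ᵖ⁻¹ π
·ᵖ-inverse u v π = mk⇔
  (λ u·π≡v → Vec-ext λ j → begin
    lookup u j                        ≡⟨ cong (lookup u) (sym (inverseʳ π)) ⟩
    lookup u (π ⟨$⟩ʳ (π ⟨$⟩ˡ j))      ≡⟨ sym (lookup∘tabulate _ (π ⟨$⟩ˡ j)) ⟩
    lookup (u ·ᵖ π) (π ⟨$⟩ˡ j)        ≡⟨ cong (λ x → lookup x (π ⟨$⟩ˡ j)) u·π≡v ⟩
    lookup v (π ⟨$⟩ˡ j)               ≡⟨ sym (lookup∘tabulate _ j) ⟩
    lookup (v ·ᵖ⁻¹ π) j               ∎)
  (λ u≡v·π⁻¹ → Vec-ext λ i → begin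
    lookup (u ·ᵖ π) i                 ≡⟨ lookup∘tabulate _ i ⟩
    lookup u (π ⟨$⟩ʳ i)               ≡⟨ cong (λ x → lookup x (π ⟨$⟩ʳ i)) u≡v·π⁻¹ ⟩
    lookup (v ·ᵖ⁻¹ π) (π ⟨$⟩ʳ i)      ≡⟨ lookup∘tabulate _ (π ⟨$⟩ʳ i) ⟩
    lookup v (π ⟨$⟩ˡ (π ⟨$⟩ʳ i))      ≡⟨ cong (lookup v) (inverseˡ π) ⟩
    lookup v i                        ∎)
  where open ≡-Reasoning

infix 4 _↭ᵖ_

record _↭ᵖ_ (u v : Vec A n) : Set where
  constructor _,_
  field
    permutation : Permutation n n
    rearranges : u ≡ v ·ᵖ permutation

↭ᵖ-refl : (u : Vec A n) → u ↭ᵖ u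
↭ᵖ-refl u = Perm.id , sym (tabulate∘lookup u)

↭ᵖ-trans : {u v w : Vec A n} → u ↭ᵖ v → v ↭ᵖ w → u ↭ᵖ w
↭ᵖ-trans (π , refl) (ρ , refl) = π ∘ₚ ρ , tabulate-cong λ i → lookup∘tabulate _ (π ⟨$⟩ʳ i)

∷-↭ᵖ : (a : A) {u v : Vec A n} → u ↭ᵖ v → a ∷ u ↭ᵖ a ∷ v
∷-↭ᵖ a (π , refl) = lift₀ π , refl

swap-↭ᵖ : (x y : A) (u : Vec A n) → x ∷ y ∷ u ↭ᵖ y ∷ x ∷ u
swap-↭ᵖ x y u = transpose zero (suc zero) , cong (λ t → x ∷ y ∷ t) (sym (tabulate∘lookup u))

∷ʳ-↭ᵖ : (u : Vec A n) (a : A) → u ∷ʳ a ↭ᵖ a ∷ u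
∷ʳ-↭ᵖ [] a = ↭ᵖ-refl _
∷ʳ-↭ᵖ (x ∷ u) a = ↭ᵖ-trans (∷-↭ᵖ x (∷ʳ-↭ᵖ u a)) (swap-↭ᵖ x a u)

reverse-↭ᵖ : (u : Vec A n) → reverse u ↭ᵖ u
reverse-↭ᵖ [] = ↭ᵖ-refl _
reverse-↭ᵖ (x ∷ u) = subst (_↭ᵖ x ∷ u) (sym (reverse-∷ x u))
  (↭ᵖ-trans (∷ʳ-↭ᵖ (reverse u) x) (∷-↭ᵖ x (reverse-↭ᵖ u)))

-- (v(I₁(w)), …, v(I_r(w))): on the word of a permutation σ this is σ·{w} (imageBlocks-·ᵖ), so
-- l_n·{w} is the image of (x₁⋯xₙ)·l_n under its linear extension.
imageBlocks : Word n r → Vec (Fin n) n → RawPart n r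
imageBlocks w v = tabulate λ k → tabulate λ j → ⌊ any? (λ i → (lookup v i ≟ j) ×-dec (lookup w i ≟ k)) ⌋

∈-imageBlocks : (w : Word n r) (v : Vec (Fin n) n) {k : Fin r} {j : Fin n} →
                j ∈ lookup (imageBlocks w v) k ⇔ (∃[ i ] (lookup v i ≡ j × lookup w i ≡ k))
∈-imageBlocks w v {k} {j} = subst (λ S → j ∈ S ⇔ (∃[ i ] (lookup v i ≡ j × lookup w i ≡ k)))
  (sym (lookup∘tabulate _ k)) (∈-tabulate (λ j → any? (λ i → (lookup v i ≟ j) ×-dec (lookup w i ≟ k))))

imageBlocks-·ᵖ : (w : Word n r) (σ : Permutation n n) → imageBlocks w (idWord n ·ᵖ σ) ≡ σ ·ᵗ blocks w
imageBlocks-·ᵖ {n} w σ = RawPart-ext λ k j → begin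
  j ∈ lookup (imageBlocks w (idWord n ·ᵖ σ)) k               ≈⟨ ∈-imageBlocks w (idWord n ·ᵖ σ) ⟩
  (∃[ i ] (lookup (idWord n ·ᵖ σ) i ≡ j × lookup w i ≡ k))  ≈⟨ mk⇔ to from ⟩
  lookup w (σ ⟨$⟩ˡ j) ≡ k                                   ≈⟨ ∈-blocks w ⟨
  σ ⟨$⟩ˡ j ∈ lookup (blocks w) k                            ≈⟨ ∈-·ᵗ σ (blocks w) ⟨
  j ∈ lookup (σ ·ᵗ blocks w) k                              ∎
  where
  open SetoidReasoning (⇔.⇔-setoid 0ℓ)
  to : ∀ {j k} → ∃[ i ] (lookup (idWord n ·ᵖ σ) i ≡ j × lookup w i ≡ k) → lookup w (σ ⟨$⟩ˡ j) ≡ k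
  to (i , σi≡j , wᵢ≡k) = trans (cong (lookup w)
    (trans (cong (σ ⟨$⟩ˡ_) (trans (sym σi≡j) (lookup-idWord-·ᵖ σ i))) (inverseˡ σ))) wᵢ≡k
  from : ∀ {j k} → lookup w (σ ⟨$⟩ˡ j) ≡ k → ∃[ i ] (lookup (idWord n ·ᵖ σ) i ≡ j × lookup w i ≡ k)
  from {j} w[σ⁻¹j]≡k = σ ⟨$⟩ˡ j , trans (lookup-idWord-·ᵖ σ _) (inverseʳ σ) , w[σ⁻¹j]≡k

-- Free modules

module FreeModule {c ℓ} (K : CommutativeRing c ℓ) where
  open CommutativeRing K
    using (Carrier; _≈_; _+_; _*_; -_; 0#; 1#; +-cong; +-identityˡ; +-identityʳ; *-identityˡ; *-identityʳ;
           reflexive; +-commutativeSemigroup)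
    renaming (refl to ≈-refl; sym to ≈-sym; trans to ≈-trans)
  open import Algebra.Properties.CommutativeSemigroup +-commutativeSemigroup using (interchange)

  private
    variable
      B C : Set

  ≃-setoid : DecidableEquality B → Setoid c ℓ
  ≃-setoid _≟_ = record
    { Carrier = LC K _
    ; _≈_ = LCEq K _≟_
    ; isEquivalence = record
      { refl = λ _ → ≈-refl
      ; sym = λ P≃Q b → ≈-sym (P≃Q b)
      ; trans = λ P≃Q Q≃R b → ≈-trans (P≃Q b) (Q≃R b)
      }
    }

  support : LC K B → List B
  support = List.map proj₂

  select : Bool → Carrier → Carrier
  select b x = if b then x else 0#

  select-cong : ∀ b {x y} → x ≈ y → select b x ≈ select b y
  select-cong true x≈y = x≈y
  select-cong false _ = ≈-refl

  select-0# : ∀ b → select b 0# ≈ 0#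
  select-0# true = ≈-refl
  select-0# false = ≈-refl

  select-+ : ∀ b x y → select b (x + y) ≈ select b x + select b y
  select-+ true _ _ = ≈-refl
  select-+ false _ _ = ≈-sym (+-identityˡ 0#)

  ∑ : List B → (B → Carrier) → Carrier
  ∑ [] F = 0#
  ∑ (s ∷ S) F = F s + ∑ S F

  ∑-cong : (S : List B) {F G : B → Carrier} → (∀ v → F v ≈ G v) → ∑ S F ≈ ∑ S G
  ∑-cong [] _ = ≈-refl
  ∑-cong (s ∷ S) F≈G = +-cong (F≈G s) (∑-cong S F≈G)

  ∑-+ : (S : List B) (F G : B → Carrier) → ∑ S (λ v → F v + G v) ≈ ∑ S F + ∑ S G
  ∑-+ [] _ _ = ≈-sym (+-identityˡ 0#)
  ∑-+ (s ∷ S) F G = ≈-trans (+-cong ≈-refl (∑-+ S F G)) (interchange (F s) (G s) (∑ S F) (∑ S G))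

  ∑-zero : (S : List B) {F : B → Carrier} → (∀ v → F v ≈ 0#) → ∑ S F ≈ 0#
  ∑-zero [] _ = ≈-refl
  ∑-zero (s ∷ S) F≈0 = ≈-trans (+-cong (F≈0 s) (∑-zero S F≈0)) (+-identityˡ 0#)

  module _ (_≟_ : DecidableEquality B) where

    ∑-select-∉ : ∀ u (S : List B) (F : B → Carrier) → All (u ≢_) S →
                 ∑ S (λ v → select (does (u ≟ v)) (F v)) ≈ 0#
    ∑-select-∉ u [] F [] = ≈-refl
    ∑-select-∉ u (s ∷ S) F (u≢s ∷ u∉S) with u ≟ s
    ... | yes u≡s = ⊥-elim (u≢s u≡s)
    ... | no _ = ≈-trans (+-identityˡ _) (∑-select-∉ u S F u∉S)

    ∑-select : ∀ u (S : List B) (F : B → Carrier) → Unique S → u ∈ₗ S →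
               ∑ S (λ v → select (does (u ≟ v)) (F v)) ≈ F u
    ∑-select u (s ∷ S) F (s∉S ∷ _) (ListAny.here refl) with u ≟ u
    ... | yes _ = ≈-trans (+-cong ≈-refl (∑-select-∉ u S F s∉S)) (+-identityʳ _)
    ... | no u≢u = ⊥-elim (u≢u refl)
    ∑-select u (s ∷ S) F (s∉S ∷ S-unique) (ListAny.there u∈S) with u ≟ s
    ... | yes refl = ⊥-elim (All.lookup s∉S u∈S refl)
    ... | no _ = ≈-trans (+-identityˡ _) (∑-select u S F S-unique u∈S)

  module LinearExtension (_≟ᴮ_ : DecidableEquality B) (_≟ᶜ_ : DecidableEquality C) (g : B → C) where

    coeff-linExt-∑ : ∀ {c} (S : List B) → Unique S → (Q : LC K B) → support Q ⊆ S →
                     coeff K _≟ᶜ_ (linExt K g Q) c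
                       ≈ ∑ S (λ v → select (does (g v ≟ᶜ c)) (coeff K _≟ᴮ_ Q v))
    coeff-linExt-∑ {c} S _ [] _ = ≈-sym (∑-zero S λ v → select-0# (does (g v ≟ᶜ c)))
    coeff-linExt-∑ {c} S S-unique ((x , u) ∷ Q) Q⊆S = begin
      select (does (g u ≟ᶜ c)) x + coeff K _≟ᶜ_ (linExt K g Q) c
        ≈⟨ +-cong (≈-sym (∑-select _≟ᴮ_ u S (λ v → onFibre v x) S-unique (Q⊆S (ListAny.here refl))))
                  (coeff-linExt-∑ S S-unique Q (Q⊆S ∘ ListAny.there)) ⟩
      ∑ S (λ v → select (does (u ≟ᴮ v)) (onFibre v x)) + ∑ S (λ v → onFibre v (coeff K _≟ᴮ_ Q v))
        ≈⟨ ∑-+ S _ _ ⟨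
      ∑ S (λ v → select (does (u ≟ᴮ v)) (onFibre v x) + onFibre v (coeff K _≟ᴮ_ Q v))
        ≈⟨ ∑-cong S (λ v → ≈-trans
             (+-cong (reflexive (select-comm (does (u ≟ᴮ v)) (does (g v ≟ᶜ c)))) ≈-refl)
             (≈-sym (select-+ (does (g v ≟ᶜ c)) _ _))) ⟩
      ∑ S (λ v → onFibre v (select (does (u ≟ᴮ v)) x + coeff K _≟ᴮ_ Q v)) ∎
      where
      open SetoidReasoning (CommutativeRing.setoid K)
      onFibre : B → Carrier → Carrier
      onFibre v y = select (does (g v ≟ᶜ c)) y
      select-comm : ∀ a b → select a (select b x) ≡ select b (select a x)
      select-comm true true = refl
      select-comm true false = refl
      select-comm false true = refl
      select-comm false false = refl

    linExt-resp : (Q R : LC K B) → LCEq K _≟ᴮ_ Q R → LCEq K _≟ᶜ_ (linExt K g Q) (linExt K g R)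
    linExt-resp Q R Q≃R c = begin
      coeff K _≟ᶜ_ (linExt K g Q) c
        ≈⟨ coeff-linExt-∑ S S-unique Q (∈-deduplicate⁺ _≟ᴮ_ ∘ ∈-++⁺ˡ) ⟩
      ∑ S (λ v → select (does (g v ≟ᶜ c)) (coeff K _≟ᴮ_ Q v))
        ≈⟨ ∑-cong S (λ v → select-cong (does (g v ≟ᶜ c)) (Q≃R v)) ⟩
      ∑ S (λ v → select (does (g v ≟ᶜ c)) (coeff K _≟ᴮ_ R v))
        ≈⟨ coeff-linExt-∑ S S-unique R (∈-deduplicate⁺ _≟ᴮ_ ∘ ∈-++⁺ʳ (support Q)) ⟨
      coeff K _≟ᶜ_ (linExt K g R) c ∎
      where
      open SetoidReasoning (CommutativeRing.setoid K)
      S : List B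
      S = deduplicate _≟ᴮ_ (support Q ++ support R)
      S-unique : Unique S
      S-unique = Unique.deduplicate-! _≟ᴮ_ _

    coeff-linExt-vanishes : ∀ {c} (Q : LC K B) → (∀ u → g u ≡ c → coeff K _≟ᴮ_ Q u ≈ 0#) →
                            coeff K _≟ᶜ_ (linExt K g Q) c ≈ 0#
    coeff-linExt-vanishes {c} Q vanishes =
      ≈-trans (coeff-linExt-∑ S (Unique.deduplicate-! _≟ᴮ_ _) Q (∈-deduplicate⁺ _≟ᴮ_))
              (∑-zero S fibre-vanishes)
      where
      S : List B
      S = deduplicate _≟ᴮ_ (support Q)
      fibre-vanishes : ∀ v → select (does (g v ≟ᶜ c)) (coeff K _≟ᴮ_ Q v) ≈ 0#
      fibre-vanishes v with g v ≟ᶜ c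
      ... | yes gv≡c = vanishes v gv≡c
      ... | no _ = ≈-refl

    linExt-span : ∀ {Basis : B → Set} {Basis′ : C → Set} → (∀ u → Basis u → Basis′ (g u)) →
                  (Q : LC K B) → InSpan K _≟ᴮ_ Basis Q → InSpan K _≟ᶜ_ Basis′ (linExt K g Q)
    linExt-span preserves Q Q∈span c c∉Basis′ =
      coeff-linExt-vanishes Q λ u gu≡c → Q∈span u λ u∈Basis →
        c∉Basis′ (subst _ gu≡c (preserves u u∈Basis))

    coeff-linExt-injective : Injective _≡_ _≡_ g → (Q : LC K B) (a : B) →
                             coeff K _≟ᶜ_ (linExt K g Q) (g a) ≡ coeff K _≟ᴮ_ Q a
    coeff-linExt-injective _ [] _ = refl
    coeff-linExt-injective g-injective ((x , u) ∷ Q) a =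
      cong₂ _+_ (cong (λ b → select b x) (does-⇔ (mk⇔ g-injective (cong g)) (g u ≟ᶜ g a) (u ≟ᴮ a)))
                (coeff-linExt-injective g-injective Q a)

    linExt-injective : Injective _≡_ _≡_ g → (P Q : LC K B) →
                       LCEq K _≟ᶜ_ (linExt K g P) (linExt K g Q) → LCEq K _≟ᴮ_ P Q
    linExt-injective g-injective P Q gP≃gQ a =
      ≈-trans (reflexive (sym (coeff-linExt-injective g-injective P a)))
        (≈-trans (gP≃gQ (g a)) (reflexive (coeff-linExt-injective g-injective Q a)))

  open LinearExtension

  coeff-linExt-fibres : ∀ {C′ : Set} (_≟ᶜ_ : DecidableEquality C) (_≟ᶜ′_ : DecidableEquality C′)
                        (g : B → C) (g′ : B → C′) {c c′} → (∀ u → (g u ≡ c) ⇔ (g′ u ≡ c′)) →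
                        (Q : LC K B) → coeff K _≟ᶜ_ (linExt K g Q) c ≡ coeff K _≟ᶜ′_ (linExt K g′ Q) c′
  coeff-linExt-fibres _ _ _ _ _ [] = refl
  coeff-linExt-fibres _≟ᶜ_ _≟ᶜ′_ g g′ {c} {c′} same-fibres ((x , u) ∷ Q) =
    cong₂ _+_ (cong (λ b → select b x) (does-⇔ (same-fibres u) (g u ≟ᶜ c) (g′ u ≟ᶜ′ c′)))
              (coeff-linExt-fibres _≟ᶜ_ _≟ᶜ′_ g g′ same-fibres Q)

  module Preimage (_≟ᴮ_ : DecidableEquality B) (_≟ᶜ_ : DecidableEquality C) (g : B → C)
                  (g-injective : Injective _≡_ _≡_ g) (g⁻¹? : ∀ c → Dec (∃[ b ] g b ≡ c)) where

    -- Terms outside the image of g are dropped, so preimage T lies in a span whenever T does.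
    preimage : LC K C → LC K B
    preimage [] = []
    preimage ((x , c) ∷ T) with g⁻¹? c
    ... | yes (b , _) = (x , b) ∷ preimage T
    ... | no _ = preimage T

    coeff-preimage : (T : LC K C) (b : B) → coeff K _≟ᴮ_ (preimage T) b ≈ coeff K _≟ᶜ_ T (g b)
    coeff-preimage [] b = ≈-refl
    coeff-preimage ((x , c) ∷ T) b with g⁻¹? c
    ... | yes (b′ , gb′≡c) = +-cong
      (reflexive (cong (λ t → select t x) (does-⇔ (mk⇔ (λ b′≡b → trans (sym gb′≡c) (cong g b′≡b))
                                                         (λ c≡gb → g-injective (trans gb′≡c c≡gb)))
                                                   (b′ ≟ᴮ b) (c ≟ᶜ g b))))
      (coeff-preimage T b)
    ... | no c∉image with c ≟ᶜ g b
    ...   | yes c≡gb = ⊥-elim (c∉image (b , sym c≡gb))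
    ...   | no _ = ≈-trans (coeff-preimage T b) (≈-sym (+-identityˡ _))

    preimage-span : ∀ {Basis : B → Set} {Basis′ : C → Set} → (∀ b → Basis′ (g b) → Basis b) →
                    (T : LC K C) → InSpan K _≟ᶜ_ Basis′ T → InSpan K _≟ᴮ_ Basis (preimage T)
    preimage-span reflects T T∈span b b∉Basis =
      ≈-trans (coeff-preimage T b) (T∈span (g b) (b∉Basis ∘ reflects b))

    linExt-preimage : ∀ {Basis′ : C → Set} → (∀ c → Basis′ c → ∃[ b ] g b ≡ c) →
                      (T : LC K C) → InSpan K _≟ᶜ_ Basis′ T → LCEq K _≟ᶜ_ (linExt K g (preimage T)) T
    linExt-preimage covered T T∈span c with g⁻¹? c
    ... | yes (b , refl) =
      ≈-trans (reflexive (coeff-linExt-injective _≟ᴮ_ _≟ᶜ_ g g-injective (preimage T) b)) (coeff-preimage T b)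
    ... | no c∉image =
      ≈-trans (coeff-linExt-vanishes _≟ᴮ_ _≟ᶜ_ g (preimage T) (λ b gb≡c → ⊥-elim (c∉image (b , gb≡c))))
              (≈-sym (T∈span c (c∉image ∘ covered c)))

  linExt-∘ : ∀ {D : Set} (g : C → D) (h : B → C) (Q : LC K B) →
             linExt K g (linExt K h Q) ≡ linExt K (g ∘ h) Q
  linExt-∘ g h [] = refl
  linExt-∘ g h ((x , u) ∷ Q) = cong ((x , g (h u)) ∷_) (linExt-∘ g h Q)

  linExt-≗ : {g h : B → C} → (∀ u → g u ≡ h u) → (Q : LC K B) → linExt K g Q ≡ linExt K h Q
  linExt-≗ g≗h [] = refl
  linExt-≗ g≗h ((x , u) ∷ Q) = cong₂ (λ v → (x , v) ∷_) (g≗h u) (linExt-≗ g≗h Q)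

  All⇒linExt : (g : B → C) (L : LC K C) → All (λ p → ∃[ b ] proj₂ p ≡ g b) L →
               ∃[ Q ] L ≡ linExt K g Q
  All⇒linExt g [] [] = [] , refl
  All⇒linExt g ((x , _) ∷ L) ((b , refl) ∷ L-in-image) =
    let Q , L≡gQ = All⇒linExt g L L-in-image in (x , b) ∷ Q , cong ((x , g b) ∷_) L≡gQ

  -- The bracketing and the actions of K𝔖ₙ

  lRev-map : ∀ {A A′ : Set} {m} (ρ : A → A′) (v : Vec A (suc m)) →
             lRev K (Vec.map ρ v) ≡ linExt K (Vec.map ρ) (lRev K v)
  lRev-map ρ (a ∷ []) = refl
  lRev-map {A} {A′} {suc m} ρ (a ∷ b ∷ u) = begin
      List.map (snoc (ρ a)) (lRev K (Vec.map ρ (b ∷ u))) ++ List.map (cons (ρ a)) (lRev K (Vec.map ρ (b ∷ u)))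
    ≡⟨ cong (λ Y → List.map (snoc (ρ a)) Y ++ List.map (cons (ρ a)) Y) (lRev-map ρ (b ∷ u)) ⟩
      List.map (snoc (ρ a)) (linExt K (Vec.map ρ) X) ++ List.map (cons (ρ a)) (linExt K (Vec.map ρ) X)
    ≡⟨ cong₂ _++_ (map-commute (λ (x , v) → cong (x ,_) (map-∷ʳ ρ a v)) X) (map-commute (λ _ → refl) X) ⟨
      linExt K (Vec.map ρ) (List.map (snoc a) X) ++ linExt K (Vec.map ρ) (List.map (cons a) X)
    ≡⟨ map-++ _ (List.map (snoc a) X) (List.map (cons a) X) ⟨
      linExt K (Vec.map ρ) (List.map (snoc a) X ++ List.map (cons a) X) ∎
    where
    open ≡-Reasoning
    X : LC K (Vec A (suc m))
    X = lRev K (b ∷ u)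
    snoc : ∀ {A : Set} → A → Carrier × Vec A (suc m) → Carrier × Vec A (suc (suc m))
    snoc a (x , v) = x , v ∷ʳ a
    cons : ∀ {A : Set} → A → Carrier × Vec A (suc m) → Carrier × Vec A (suc (suc m))
    cons a (x , v) = - x , a ∷ v

  lBr-map : ∀ {A A′ : Set} {m} (ρ : A → A′) (v : Vec A (suc m)) →
            lBr K (Vec.map ρ v) ≡ linExt K (Vec.map ρ) (lBr K v)
  lBr-map ρ v = trans (cong (lRev K) (sym (map-reverse ρ v))) (lRev-map ρ (reverse v))

  lRev-↭ᵖ : ∀ {A : Set} {m} (v : Vec A (suc m)) → All (λ p → proj₂ p ↭ᵖ v) (lRev K v)
  lRev-↭ᵖ (a ∷ []) = ↭ᵖ-refl _ ∷ []
  lRev-↭ᵖ (a ∷ b ∷ u) =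
    ++⁺ (map⁺ (All.map (λ p↭ → ↭ᵖ-trans (∷ʳ-↭ᵖ _ a) (∷-↭ᵖ a p↭)) (lRev-↭ᵖ (b ∷ u))))
        (map⁺ (All.map (∷-↭ᵖ a) (lRev-↭ᵖ (b ∷ u))))

  -- The witness is l_n itself: l commutes with renaming letters, and every term of l(x₁⋯xₙ)
  -- rearranges x₁⋯xₙ.
  lBr-·ᵖ : ∀ m → ∃[ Q ] (∀ {A : Set} (v : Vec A (suc m)) → lBr K v ≡ linExt K (v ·ᵖ_) Q)
  lBr-·ᵖ m = Q , λ v → begin
      lBr K v                                             ≡⟨ cong (lBr K) (map-lookup-idWord v) ⟨
      lBr K (Vec.map (lookup v) ι)                        ≡⟨ lBr-map (lookup v) ι ⟩
      linExt K (Vec.map (lookup v)) (lBr K ι)             ≡⟨ cong (linExt K (Vec.map (lookup v))) lBr-ι ⟩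
      linExt K (Vec.map (lookup v)) (linExt K (ι ·ᵖ_) Q)  ≡⟨ linExt-∘ _ _ Q ⟩
      linExt K (λ π → Vec.map (lookup v) (ι ·ᵖ π)) Q      ≡⟨ linExt-≗ (map-lookup-·ᵖ v) Q ⟩
      linExt K (v ·ᵖ_) Q                                  ∎
    where
    open ≡-Reasoning
    ι : Vec (Fin (suc m)) (suc m)
    ι = idWord (suc m)
    terms-are-permutations : ∃[ Q ] lBr K ι ≡ linExt K (ι ·ᵖ_) Q
    terms-are-permutations = All⇒linExt (ι ·ᵖ_) (lBr K ι)
      (All.map (λ p↭ → let π , p≡ι·π = ↭ᵖ-trans p↭ (reverse-↭ᵖ ι) in π , p≡ι·π)
               (lRev-↭ᵖ (reverse ι)))
    Q : GroupAlg K (suc m)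
    Q = proj₁ terms-are-permutations
    lBr-ι : lBr K ι ≡ linExt K (ι ·ᵖ_) Q
    lBr-ι = proj₂ terms-are-permutations

  actR-basis : (w : Word n r) (X : GroupAlg K n) →
               LCEq K _≟ʷ_ (actR K (basis K w) X) (linExt K (w ·ᵖ_) X)
  actR-basis w [] v = ≈-refl
  actR-basis w ((y , σ) ∷ X) v =
    +-cong (select-cong (does ((w ·ᵖ σ) ≟ʷ v)) (*-identityˡ y)) (actR-basis w X v)

  actL-basis : (I : RawPart n r) (X : GroupAlg K n) →
               LCEq K _≟ᵖ_ (actL K X (basis K I)) (linExt K (_·ᵗ I) X)
  actL-basis I [] b = ≈-refl
  actL-basis I ((y , σ) ∷ X) b =
    +-cong (select-cong (does ((σ ·ᵗ I) ≟ᵖ b)) (*-identityʳ y)) (actL-basis I X b)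

  actL-singleton : (σ : Permutation n n) (T : LC K (RawPart n r)) →
                   LCEq K _≟ᵖ_ (actL K ((1# , σ) ∷ []) T) (linExt K (σ ·ᵗ_) T)
  actL-singleton σ [] b = ≈-refl
  actL-singleton σ ((x , I) ∷ T) b =
    +-cong (select-cong (does ((σ ·ᵗ I) ≟ᵖ b)) (*-identityˡ x)) (actL-singleton σ T b)

  f-equivariant : (σ : Permutation n n) (P : LC K (Word n r)) →
                  LCEq K _≟ᵖ_ (f K (actInvW K σ P)) (actL K ((1# , σ) ∷ []) (f K P))
  f-equivariant σ P = begin
    linExt K blocks (linExt K (_·ᵖ⁻¹ σ) P)      ≡⟨ linExt-∘ blocks (_·ᵖ⁻¹ σ) P ⟩
    linExt K (λ w → blocks (w ·ᵖ⁻¹ σ)) P        ≡⟨ linExt-≗ (blocks-·ᵖ⁻¹ σ) P ⟩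
    linExt K (λ w → σ ·ᵗ blocks w) P            ≡⟨ linExt-∘ (σ ·ᵗ_) blocks P ⟨
    linExt K (σ ·ᵗ_) (f K P)                    ≈⟨ actL-singleton σ (f K P) ⟨
    actL K ((1# , σ) ∷ []) (f K P)              ∎
    where open SetoidReasoning (≃-setoid _≟ᵖ_)

  f-actR-basis : (w : Word n r) (X : GroupAlg K n) →
                 LCEq K _≟ᵖ_ (f K (actR K (basis K w) X))
                             (linExt K (blocks ∘ Vec.map (lookup w)) (actR K (basis K (idWord n)) X))
  f-actR-basis {n} w X = begin
    f K (actR K (basis K w) X)
      ≈⟨ linExt-resp _≟ʷ_ _≟ᵖ_ blocks (actR K (basis K w) X) (linExt K (w ·ᵖ_) X) (actR-basis w X) ⟩
    linExt K blocks (linExt K (w ·ᵖ_) X)                     ≡⟨ linExt-∘ blocks (w ·ᵖ_) X ⟩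
    linExt K (λ σ → blocks (w ·ᵖ σ)) X                       ≡⟨ linExt-≗ (cong blocks ∘ map-lookup-·ᵖ w) X ⟨
    linExt K (λ σ → blocks (Vec.map (lookup w) (ι ·ᵖ σ))) X  ≡⟨ linExt-∘ (blocks ∘ Vec.map (lookup w)) (ι ·ᵖ_) X ⟨
    linExt K (blocks ∘ Vec.map (lookup w)) (linExt K (ι ·ᵖ_) X)
      ≈⟨ linExt-resp _≟ʷ_ _≟ᵖ_ _ (actR K (basis K ι) X) (linExt K (ι ·ᵖ_) X) (actR-basis ι X) ⟨
    linExt K (blocks ∘ Vec.map (lookup w)) (actR K (basis K ι) X) ∎
    where
    open SetoidReasoning (≃-setoid _≟ᵖ_)
    ι : Vec (Fin n) n
    ι = idWord n

  actL-basis-imageBlocks : (w : Word n r) (X : GroupAlg K n) →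
                           LCEq K _≟ᵖ_ (actL K X (basis K (blocks w)))
                                       (linExt K (imageBlocks w) (actR K (basis K (idWord n)) X))
  actL-basis-imageBlocks {n} w X = begin
    actL K X (basis K (blocks w))                       ≈⟨ actL-basis (blocks w) X ⟩
    linExt K (_·ᵗ blocks w) X                           ≡⟨ linExt-≗ (imageBlocks-·ᵖ w) X ⟨
    linExt K (λ σ → imageBlocks w (ι ·ᵖ σ)) X           ≡⟨ linExt-∘ (imageBlocks w) (ι ·ᵖ_) X ⟨
    linExt K (imageBlocks w) (linExt K (ι ·ᵖ_) X)
      ≈⟨ linExt-resp _≟ʷ_ _≟ᵖ_ _ (actR K (basis K ι) X) (linExt K (ι ·ᵖ_) X) (actR-basis ι X) ⟨
    linExt K (imageBlocks w) (actR K (basis K ι) X)     ∎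
    where
    open SetoidReasoning (≃-setoid _≟ᵖ_)
    ι : Vec (Fin n) n
    ι = idWord n

  -- (l^*(x₁⋯xₙ), v) = (l(v), x₁⋯xₙ) collects the terms v·π of v·l_n equal to x₁⋯xₙ, that is
  -- those with v = x₁⋯xₙ·π⁻¹.
  idWord-lnStar-inverts : ∀ {m} (Q : GroupAlg K (suc m)) →
    (∀ (v : Vec (Fin (suc m)) (suc m)) → lBr K v ≡ linExt K (v ·ᵖ_) Q) → (lnStar : GroupAlg K (suc m)) →
    (∀ v → coeff K _≟ʷ_ (actR K (basis K (idWord (suc m))) lnStar) v
             ≈ coeff K _≟ʷ_ (lBr K v) (idWord (suc m))) →
    LCEq K _≟ʷ_ (actR K (basis K (idWord (suc m))) lnStar) (linExt K (idWord (suc m) ·ᵖ⁻¹_) Q)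
  idWord-lnStar-inverts {m} Q lBr≡ lnStar adjoint v = begin
    coeff K _≟ʷ_ (actR K (basis K ι) lnStar) v    ≈⟨ adjoint v ⟩
    coeff K _≟ʷ_ (lBr K v) ι                      ≡⟨ cong (λ L → coeff K _≟ʷ_ L ι) (lBr≡ v) ⟩
    coeff K _≟ʷ_ (linExt K (v ·ᵖ_) Q) ι
      ≡⟨ coeff-linExt-fibres _≟ʷ_ _≟ʷ_ (v ·ᵖ_) (ι ·ᵖ⁻¹_) same-fibres Q ⟩
    coeff K _≟ʷ_ (linExt K (ι ·ᵖ⁻¹_) Q) v         ∎
    where
    open SetoidReasoning (CommutativeRing.setoid K)
    ι : Vec (Fin (suc m)) (suc m)
    ι = idWord (suc m)
    same-fibres : ∀ π → (v ·ᵖ π ≡ ι) ⇔ (ι ·ᵖ⁻¹ π ≡ v)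
    same-fibres π = ⇔.trans (·ᵖ-inverse v ι π) (mk⇔ sym sym)

  f-lnStar : ∀ {m} (ln lnStar : GroupAlg K (suc m)) →
    LCEq K _≟ʷ_ (actR K (basis K (idWord (suc m))) ln) (lBr K (idWord (suc m))) →
    (∀ v → coeff K _≟ʷ_ (actR K (basis K (idWord (suc m))) lnStar) v
             ≈ coeff K _≟ʷ_ (lBr K v) (idWord (suc m))) →
    (w : Word (suc m) r) → LCEq K _≟ᵖ_ (f K (actR K (basis K w) lnStar)) (actL K ln (basis K (blocks w)))
  f-lnStar {r = r} {m = m} ln lnStar ι·ln≃lι adjoint w = begin
    f K (actR K (basis K w) lnStar)                   ≈⟨ f-actR-basis w lnStar ⟩
    linExt K F (actR K (basis K ι) lnStar)
      ≈⟨ linExt-resp _≟ʷ_ _≟ᵖ_ F (actR K (basis K ι) lnStar) (linExt K (ι ·ᵖ⁻¹_) Q)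
                     (idWord-lnStar-inverts Q lBr≡ lnStar adjoint) ⟩
    linExt K F (linExt K (ι ·ᵖ⁻¹_) Q)                 ≡⟨ linExt-∘ F (ι ·ᵖ⁻¹_) Q ⟩
    linExt K (λ π → F (ι ·ᵖ⁻¹ π)) Q
      ≡⟨ linExt-≗ (λ π → trans (cong blocks (map-lookup-·ᵖ⁻¹ w π)) (blocks-·ᵖ⁻¹ π w)) Q ⟩
    linExt K (_·ᵗ blocks w) Q                         ≡⟨ linExt-≗ (imageBlocks-·ᵖ w) Q ⟨
    linExt K (λ π → imageBlocks w (ι ·ᵖ π)) Q         ≡⟨ linExt-∘ (imageBlocks w) (ι ·ᵖ_) Q ⟨
    linExt K (imageBlocks w) (linExt K (ι ·ᵖ_) Q)     ≡⟨ cong (linExt K (imageBlocks w)) (lBr≡ ι) ⟨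
    linExt K (imageBlocks w) (lBr K ι)
      ≈⟨ linExt-resp _≟ʷ_ _≟ᵖ_ (imageBlocks w) (actR K (basis K ι) ln) (lBr K ι) ι·ln≃lι ⟨
    linExt K (imageBlocks w) (actR K (basis K ι) ln)  ≈⟨ actL-basis-imageBlocks w ln ⟨
    actL K ln (basis K (blocks w))                    ∎
    where
    open SetoidReasoning (≃-setoid _≟ᵖ_)
    ι : Vec (Fin (suc m)) (suc m)
    ι = idWord (suc m)
    F : Vec (Fin (suc m)) (suc m) → RawPart (suc m) r
    F = blocks ∘ Vec.map (lookup w)
    Q : GroupAlg K (suc m)
    Q = proj₁ (lBr-·ᵖ m)
    lBr≡ : ∀ {A : Set} (v : Vec A (suc m)) → lBr K v ≡ linExt K (v ·ᵖ_) Q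
    lBr≡ = proj₂ (lBr-·ᵖ m)

theorem4p3 : ∀ {c ℓ} (K : CommutativeRing c ℓ) (m r : ℕ) →
  let n = suc m
      open CommutativeRing K using (_≈_)
      EqW = LCEq K (_≟ʷ_ {n} {r})
      EqP = LCEq K (_≟ᵖ_ {n} {r})
      InW = InSpan K (_≟ʷ_ {n} {r}) AlphIsB
      InP = InSpan K (_≟ᵖ_ {n} {r}) IsOSP
  in
  (∀ (P Q : LC K (Word n r)) → EqW P Q → EqP (f K P) (f K Q)) ×
  (∀ (P : LC K (Word n r)) → InW P → InP (f K P)) ×
  (∀ (P Q : LC K (Word n r)) → InW P → InW Q → EqP (f K P) (f K Q) → EqW P Q) ×
  (∀ (T : LC K (RawPart n r)) → InP T → ∃[ P ] (InW P × EqP (f K P) T)) ×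
  (∀ (σ : Permutation n n) (P : LC K (Word n r)) → InW P →
     EqP (f K (actInvW K σ P)) (actL K ((CommutativeRing.1# K , σ) ∷ []) (f K P))) ×
  (∀ (λ' : Vec ℕ r) → IsPartitionWithParts n r λ' →
     (∀ (P : LC K (Word n r)) → InSpan K _≟ʷ_ (HasContent λ') P → InSpan K _≟ᵖ_ (IsTabloid λ') (f K P)) ×
     (∀ (T : LC K (RawPart n r)) → InSpan K _≟ᵖ_ (IsTabloid λ') T →
        ∃[ P ] (InSpan K _≟ʷ_ (HasContent λ') P × EqP (f K P) T))) ×
  (∀ (ln lnStar : GroupAlg K n) →
     LCEq K _≟ʷ_ (actR K (basis K (idWord n)) ln) (lBr K (idWord n)) →
     (∀ (v : Vec (Fin n) n) →
        coeff K _≟ʷ_ (actR K (basis K (idWord n)) lnStar) v ≈ coeff K _≟ʷ_ (lBr K v) (idWord n)) →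
     ∀ (w : Word n r) → AlphIsB w →
       EqP (f K (actR K (basis K w) lnStar)) (actL K ln (basis K (blocks w))))
-- f is injective on the whole free module, and the last identity holds for every word.
theorem4p3 K m r =
  linExt-resp ,
  linExt-span AlphIsB⇒IsOSP ,
  (λ P Q _ _ → linExt-injective blocks-injective P Q) ,
  (λ T T∈span → preimage T , preimage-span IsOSP⇒AlphIsB T T∈span , linExt-preimage IsOSP⇒blocks T T∈span) ,
  (λ σ P _ → f-equivariant σ P) ,
  (λ λ' (_ , positive , _) →
     linExt-span (HasContent⇒IsTabloid λ' positive) ,
     λ T T∈span → preimage T , preimage-span (IsTabloid⇒HasContent λ') T T∈span ,
                   linExt-preimage (λ I tabloid → IsOSP⇒blocks I (proj₁ tabloid)) T T∈span) ,
  λ ln lnStar ι·ln≃lι adjoint w _ → f-lnStar ln lnStar ι·ln≃lι adjoint w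
  where
  open FreeModule K
  open LinearExtension (_≟ʷ_ {suc m} {r}) _≟ᵖ_ blocks
  open Preimage (_≟ʷ_ {suc m} {r}) _≟ᵖ_ blocks blocks-injective blocks⁻¹?
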